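{- Let $3\le s\le t\le u$ be integers. (1) If $4\le s\le t\le u$, then $S(3;s,t,u)\ge stu-tu-u-1$. (2) If either $3=t<u$ or $3<t\le u$, then $S(3;3,t,u)>2tu-u-1$ (equivalently, $S(3;3,t,u)>3tu-tu-u-1$).
   Context: For an integer $k\ge 3$, let $\mathcal{L}(k)$ denote the linear equation $x_1+x_2+\cdots+x_{k-1}=x_k$ in positive integer variables. For integers $r\ge 1$ and $k_0,\dots,k_{r-1}\ge 3$, the generalized Schur number $S(r;k_0,\dots,k_{r-1})$ is the least positive integer $N$ such that for every coloring of $[1,N]=\{1,2,\dots,N\}$ with the $r$ colors $0,1,\dots,r-1$, there is some $i\in\{0,\dots,r-1\}$ and a solution $(x_1,\dots,x_{k_i})$ of $\mathcal{L}(k_i)$ with all $x_j\in[1,N]$ colored $i$. Thus $S(3;s,t,u)$ is the least $N$ such that every 3-coloring of $[1,N]$ contains a solution of $\mathcal{L}(s)$ monochromatic in the first color, or of $\mathcal{L}(t)$ monochromatic in the second color, or of $\mathcal{L}(u)$ monochromatic in the third color. -}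

module Defs where

open import Data.Nat using (ℕ; _+_; _∸_; _≤_; _<_)
open import Data.Fin using (Fin)
open import Data.Product using (Σ; _×_; ∃)
open import Relation.Binary.PropositionalEquality using (_≡_)
open import Relation.Nullary using (¬_)

sumF : (n : ℕ) → (Fin n → ℕ) → ℕ
sumF ℕ.zero f = 0
sumF (ℕ.suc n) f = f Fin.zero + sumF n (λ j → f (Fin.suc j))

InRange : ℕ → ℕ → Set
InRange N x = 1 ≤ x × x ≤ N

-- An r-colouring of [1,N]; values outside [1,N] are irrelevant.
Colouring : ℕ → Set
Colouring r = ℕ → Fin r

-- A solution (x_1,…,x_k) of L(k): x_1+…+x_{k-1} = x_k, all in [1,N] and of colour i.
-- The variables x_1..x_{k-1} are given by xs; x_k is forced to be their sum.
MonoSol : {r : ℕ} → ℕ → Colouring r → Fin r → ℕ → Set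
MonoSol N c i k =
  Σ (Fin (k ∸ 1) → ℕ) λ xs →
    ((j : Fin (k ∸ 1)) → InRange N (xs j) × c (xs j) ≡ i)
    × InRange N (sumF (k ∸ 1) xs) × c (sumF (k ∸ 1) xs) ≡ i

SchurProperty : (r : ℕ) → (Fin r → ℕ) → ℕ → Set
SchurProperty r ks N = (c : Colouring r) → ∃ λ (i : Fin r) → MonoSol N c i (ks i)

IsSchurNumber : (r : ℕ) → (Fin r → ℕ) → ℕ → Set
IsSchurNumber r ks N =
  1 ≤ N × SchurProperty r ks N × ((M : ℕ) → 1 ≤ M → M < N → ¬ SchurProperty r ks M)

{-# OPTIONS --safe #-}
-- A colour class contains no monochromatic solution of L(k) exactly when it contains no
-- sum of k - 1 of its elements, and both bounds come from colourings of an initial segment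
-- by consecutive blocks.
--
-- (1) Write I = [1, s-2], P = (s-1)(t-1) - 1, Q = (u-1)(P+s-1) - 1, J = [s-1, P]. Colour 0 is
-- I ∪ (P+I) ∪ Q+(I ∪ (P+I)), colour 1 is J ∪ (Q+J) and colour 2 is [P+s-1, Q], which
-- covers [1, stu-tu-u-2]. An n-fold sum of elements of an interval (a, b] exceeds b as soon
-- as n(a+1) > b, and sum-freeness survives the doubling L ↦ L ∪ (Q+L) when L ⊆ [1, B] and
-- nB ≤ Q: a sum with no shifted summand is at most nB ≤ Q, a sum with exactly one is Q plus
-- an n-fold sum of L, and a sum with two or more exceeds 2Q ≥ Q + B.
--
-- (2) Write β = 2t-3 and A = (u-1)(2t-1). Colour 0 is {1, β+1, β+3, A, A+2}, colour 1 is
-- [2, β] ∪ [A+3, 2tu-u-1] and colour 2 is {β+2} ∪ [β+4, A-1] ∪ {A+1}. Colour 0 has no two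
-- consecutive elements and its elements other than 1 lie in two bands too far apart for a
-- sum of two of them to land in either band. A (t-1)-fold sum from [2, β] lies in
-- [β+1, A], one with a summand ≥ A+3 exceeds 2tu-u-1, and a (u-1)-fold sum of colour 2
-- is A if all summands are β+2 and at least A+2 otherwise.
module Submission where

open import Defs
open import Data.Nat using (ℕ; _*_; _+_; _∸_; _≤_; _<_)
open import Data.Vec using (lookup; _∷_; [])
open import Data.Product using (_×_)
open import Data.Sum using (_⊎_)
open import Relation.Binary.PropositionalEquality using (_≡_)

open import Data.Fin using (Fin)
open import Data.Fin.Patterns using (0F; 1F; 2F)
open import Data.List using (List; []; _∷_)
open import Data.Nat using (zero; suc; pred; z≤n; s≤s; z<s; _≤?_)
open import Data.Nat.Properties
open import Algebra.Properties.CommutativeSemigroup +-commutativeSemigroup using (x∙yz≈y∙xz)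
open import Data.Nat.Tactic.RingSolver using (solve-∀)
open import Data.Product using (Σ; ∃; _,_; proj₁; proj₂)
open import Data.Sum using (inj₁; inj₂)
open import Function using (_∘_; id)
open import Level using (0ℓ)
open import Relation.Binary.PropositionalEquality using (refl; sym; cong; subst)
open import Relation.Nullary using (¬_; yes; no)
open import Relation.Unary using (Pred; _⊆_; _∪_)

Ioc : ℕ → ℕ → Pred ℕ 0ℓ
Ioc a b x = a < x × x ≤ b

Ioc-singleton : ∀ {a x} → Ioc a (suc a) x → x ≡ suc a
Ioc-singleton (a<x , x≤1+a) = ≤-antisym x≤1+a a<x

Shift : ℕ → Pred ℕ 0ℓ → Pred ℕ 0ℓ
Shift a C x = Σ ℕ λ y → C y × x ≡ a + y

Shift-mono : ∀ {C D : Pred ℕ 0ℓ} {a} → C ⊆ D → Shift a C ⊆ Shift a D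
Shift-mono C⊆D (y , y∈C , x≡a+y) = y , C⊆D y∈C , x≡a+y

Shift-+ : ∀ {C : Pred ℕ 0ℓ} {a b} → Shift (a + b) C ⊆ Shift a (Shift b C)
Shift-+ {a = a} {b} (y , y∈C , refl) = b + y , (y , y∈C , refl) , +-assoc a b y

Ioc-Shift : ∀ {a b c} → Ioc (a + b) (a + c) ⊆ Shift a (Ioc b c)
Ioc-Shift {a} {b} {c} {x} (a+b<x , x≤a+c) = x ∸ a , (b<x∸a , x∸a≤c) , sym (m+[n∸m]≡n a≤x)
  where
  a≤x : a ≤ x
  a≤x = ≤-trans (m≤m+n a b) (<⇒≤ a+b<x)

  b<x∸a : b < x ∸ a
  b<x∸a = subst (_< x ∸ a) (m+n∸m≡n a b) (∸-monoˡ-< a+b<x (m≤m+n a b))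

  x∸a≤c : x ∸ a ≤ c
  x∸a≤c = subst (x ∸ a ≤_) (m+n∸m≡n a c) (∸-monoˡ-≤ a x≤a+c)

Ioc-Shift₀ : ∀ {a c} → Ioc a (a + c) ⊆ Shift a (Ioc 0 c)
Ioc-Shift₀ {a} {x = x} (a<x , x≤a+c) = Ioc-Shift (subst (_< x) (sym (+-identityʳ a)) a<x , x≤a+c)

Twin : ℕ → Pred ℕ 0ℓ
Twin a x = x ≡ a ⊎ x ≡ 2 + a

Twin⇒≥ : ∀ {a} → Twin a ⊆ (a ≤_)
Twin⇒≥ (inj₁ refl) = ≤-refl
Twin⇒≥ (inj₂ refl) = m≤n+m _ 2

Twin⇒≤ : ∀ {a} → Twin a ⊆ (_≤ 2 + a)
Twin⇒≤ (inj₁ refl) = m≤n+m _ 2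
Twin⇒≤ (inj₂ refl) = ≤-refl

-- Each case is refuted by the unifier's cycle check, e.g. on suc a ≡ a.
Twin-isolated : ∀ {a x} → Twin a x → ¬ Twin a (suc x)
Twin-isolated (inj₁ refl) (inj₁ ())
Twin-isolated (inj₁ refl) (inj₂ ())
Twin-isolated (inj₂ refl) (inj₁ ())
Twin-isolated (inj₂ refl) (inj₂ ())

data SumOf (C : Pred ℕ 0ℓ) : ℕ → Pred ℕ 0ℓ where
  []  : SumOf C 0 0
  _∷_ : ∀ {x n σ} → C x → SumOf C n σ → SumOf C (suc n) (x + σ)

SumFree : ℕ → Pred ℕ 0ℓ → Set
SumFree n C = ∀ {σ} → SumOf C n σ → ¬ C σ

module _ {C D : Pred ℕ 0ℓ} where

  SumOf-mono : ∀ {n} → C ⊆ D → SumOf C n ⊆ SumOf D n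
  SumOf-mono C⊆D []      = []
  SumOf-mono C⊆D (x ∷ s) = C⊆D x ∷ SumOf-mono C⊆D s

  SumFree-anti : ∀ {n} → C ⊆ D → SumFree n D → SumFree n C
  SumFree-anti C⊆D free s σ∈C = free (SumOf-mono C⊆D s) (C⊆D σ∈C)

module _ {C : Pred ℕ 0ℓ} where

  sumF∈SumOf : ∀ n (xs : Fin n → ℕ) → (∀ j → C (xs j)) → SumOf C n (sumF n xs)
  sumF∈SumOf zero    xs xs∈C = []
  sumF∈SumOf (suc n) xs xs∈C =
    xs∈C Fin.zero ∷ sumF∈SumOf n (xs ∘ Fin.suc) (xs∈C ∘ Fin.suc)

  SumOf-≥ : ∀ {a n} → C ⊆ (a ≤_) → SumOf C n ⊆ (n * a ≤_)
  SumOf-≥ C≥a []      = z≤n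
  SumOf-≥ C≥a (x ∷ s) = +-mono-≤ (C≥a x) (SumOf-≥ C≥a s)

  SumOf-≤ : ∀ {b n} → C ⊆ (_≤ b) → SumOf C n ⊆ (_≤ n * b)
  SumOf-≤ C≤b []      = z≤n
  SumOf-≤ C≤b (x ∷ s) = +-mono-≤ (C≤b x) (SumOf-≤ C≤b s)

SumOf-≡ : ∀ {a n} → SumOf (_≡ a) n ⊆ (_≡ n * a)
SumOf-≡ []         = refl
SumOf-≡ (refl ∷ s) = cong (_ +_) (SumOf-≡ s)

SumOf-∪ : ∀ {C D : Pred ℕ 0ℓ} {a b n σ} → C ⊆ (a ≤_) → D ⊆ (b ≤_) → a ≤ b →
          SumOf (C ∪ D) (suc n) σ → SumOf C (suc n) σ ⊎ b + n * a ≤ σ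
SumOf-∪ {C} {D} {a} {b} C≥a D≥b a≤b (inj₂ x∈D ∷ s) =
  inj₂ (+-mono-≤ (D≥b x∈D) (SumOf-≥ C∪D≥a s))
  where
  C∪D≥a : C ∪ D ⊆ (a ≤_)
  C∪D≥a (inj₁ x∈C) = C≥a x∈C
  C∪D≥a (inj₂ x∈D) = ≤-trans a≤b (D≥b x∈D)
SumOf-∪ C≥a D≥b a≤b (inj₁ x∈C ∷ []) = inj₁ (x∈C ∷ [])
SumOf-∪ {a = a} {b} C≥a D≥b a≤b (inj₁ x∈C ∷ s@(_ ∷ _)) with SumOf-∪ C≥a D≥b a≤b s
... | inj₁ s′  = inj₁ (x∈C ∷ s′)
... | inj₂ big = inj₂ (≤-trans (≤-reflexive (x∙yz≈y∙xz b a _)) (+-mono-≤ (C≥a x∈C) big))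

SumFree-Ioc : ∀ {a b n} → b < n * suc a → SumFree n (Ioc a b)
SumFree-Ioc b<n[1+a] s (_ , σ≤b) = <⇒≱ (≤-<-trans σ≤b b<n[1+a]) (SumOf-≥ proj₁ s)

module _ {L : Pred ℕ 0ℓ} {B Q : ℕ} (L⊆ : L ⊆ Ioc 0 B) where

  ∪-Shift-⊆ : L ∪ Shift Q L ⊆ Ioc 0 (Q + B)
  ∪-Shift-⊆ (inj₁ x∈L) =
    proj₁ (L⊆ x∈L) , ≤-trans (proj₂ (L⊆ x∈L)) (m≤n+m B Q)
  ∪-Shift-⊆ (inj₂ (y , y∈L , refl)) =
    <-≤-trans (proj₁ (L⊆ y∈L)) (m≤n+m y Q) , +-monoʳ-≤ Q (proj₂ (L⊆ y∈L))

  private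
    L-positive : L ⊆ (0 <_)
    L-positive = proj₁ ∘ L⊆

    add-positive : ∀ {x n σ} → 0 < x → Q + Q + n ≤ σ → Q + Q + suc n ≤ x + σ
    add-positive {x} {n} {σ} 0<x big = subst (_≤ x + σ) (sym (+-suc (Q + Q) n)) (+-mono-≤ 0<x big)

  SumOf-∪-Shift : ∀ {n σ} → SumOf (L ∪ Shift Q L) n σ →
                  SumOf L n σ ⊎ Shift Q (SumOf L n) σ ⊎ Q + Q + n ≤ σ
  SumOf-∪-Shift [] = inj₁ []
  SumOf-∪-Shift (inj₁ x∈L ∷ s) with SumOf-∪-Shift s
  ... | inj₁ s′                      = inj₁ (x∈L ∷ s′)
  ... | inj₂ (inj₁ (σ′ , s′ , refl)) = inj₂ (inj₁ (_ + σ′ , x∈L ∷ s′ , x∙yz≈y∙xz _ Q σ′))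
  ... | inj₂ (inj₂ big)              = inj₂ (inj₂ (add-positive (L-positive x∈L) big))
  SumOf-∪-Shift (inj₂ (y , y∈L , refl) ∷ s) with SumOf-∪-Shift s
  ... | inj₁ s′                      = inj₂ (inj₁ (y + _ , y∈L ∷ s′ , +-assoc Q y _))
  ... | inj₂ (inj₁ (σ′ , s′ , refl)) =
    inj₂ (inj₂ (two-shifted (L-positive y∈L) (SumOf-≥ L-positive s′)))
    where
    two-shifted : ∀ {n} → 0 < y → n * 1 ≤ σ′ → Q + Q + suc n ≤ Q + y + (Q + σ′)
    two-shifted {n} 0<y n≤σ′ = subst (_≤ Q + y + (Q + σ′)) (rearrange Q n)
      (+-mono-≤ (+-monoʳ-≤ Q 0<y) (+-monoʳ-≤ Q n≤σ′))
      where
      rearrange : ∀ q n → q + 1 + (q + n * 1) ≡ q + q + suc n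
      rearrange = solve-∀
  ... | inj₂ (inj₂ big) =
    inj₂ (inj₂ (add-positive (<-≤-trans (L-positive y∈L) (m≤n+m y Q)) big))

  SumFree-∪-Shift : ∀ {n} → suc n * B ≤ Q →
                    SumFree (suc n) L → SumFree (suc n) (L ∪ Shift Q L)
  SumFree-∪-Shift {n} [1+n]B≤Q free s = excluded (SumOf-∪-Shift s)
    where
    B≤Q : B ≤ Q
    B≤Q = ≤-trans (m≤m+n B (n * B)) [1+n]B≤Q

    Q+Q<Q+Q+[1+n] : Q + Q < Q + Q + suc n
    Q+Q<Q+Q+[1+n] = m<m+n (Q + Q) z<s

    excluded : ∀ {σ} → SumOf L (suc n) σ ⊎ Shift Q (SumOf L (suc n)) σ ⊎ Q + Q + suc n ≤ σ →
               ¬ (L ∪ Shift Q L) σ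
    excluded (inj₁ s′) (inj₁ σ∈L) = free s′ σ∈L
    excluded (inj₁ s′) (inj₂ (y , y∈L , refl)) =
      <⇒≱ (m<m+n Q (L-positive y∈L)) (≤-trans (SumOf-≤ (proj₂ ∘ L⊆) s′) [1+n]B≤Q)
    excluded (inj₂ (inj₁ (σ′ , s′ , refl))) (inj₁ σ∈L) =
      <⇒≱ (m<m+n Q (≤-trans (s≤s z≤n) (SumOf-≥ L-positive s′)))
          (≤-trans (proj₂ (L⊆ σ∈L)) B≤Q)
    excluded (inj₂ (inj₁ (σ′ , s′ , refl))) (inj₂ (y , y∈L , Q+σ′≡Q+y)) =
      free s′ (subst L (+-cancelˡ-≡ Q y σ′ (sym Q+σ′≡Q+y)) y∈L)
    excluded (inj₂ (inj₂ big)) (inj₁ σ∈L) =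
      <⇒≱ (≤-<-trans (≤-trans (proj₂ (L⊆ σ∈L)) (≤-trans B≤Q (m≤m+n Q Q))) Q+Q<Q+Q+[1+n])
          big
    excluded (inj₂ (inj₂ big)) (inj₂ (y , y∈L , refl)) =
      <⇒≱ (≤-<-trans (+-monoʳ-≤ Q (≤-trans (proj₂ (L⊆ y∈L)) B≤Q)) Q+Q<Q+Q+[1+n]) big

Coloured : ∀ {r} → ℕ → Colouring r → Fin r → Pred ℕ 0ℓ
Coloured N c i x = InRange N x × c x ≡ i

module _ {r} (c : Colouring r) {i : Fin r} where

  Coloured-mono : ∀ {M N} → N ≤ M → Coloured N c i ⊆ Coloured M c i
  Coloured-mono N≤M ((1≤x , x≤N) , cx≡i) = (1≤x , ≤-trans x≤N N≤M) , cx≡i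

  MonoSol⇒SumOf : ∀ {N k} → MonoSol N c i k →
                  ∃ λ σ → SumOf (Coloured N c i) (k ∸ 1) σ × Coloured N c i σ
  MonoSol⇒SumOf {k = k} (xs , xs-coloured , σ-coloured) =
    sumF (k ∸ 1) xs , sumF∈SumOf (k ∸ 1) xs xs-coloured , σ-coloured

schur-lower-bound : ∀ {r M N} (ks : Fin r → ℕ) (c : Colouring r) →
                    (∀ i → SumFree (ks i ∸ 1) (Coloured M c i)) → SchurProperty r ks N → M < N
schur-lower-bound ks c free schur = ≰⇒> λ N≤M →
  let (i , solution) = schur c
      (σ , sum , σ-coloured) = MonoSol⇒SumOf c {k = ks i} solution
  in  SumFree-anti (Coloured-mono c N≤M) (free i) sum σ-coloured

paint : ∀ {r} → List (ℕ × Fin r) → Fin r → Colouring r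
paint []             d x = d
paint ((b , j) ∷ bs) d x with x ≤? b
... | yes _ = j
... | no  _ = paint bs d x

-- Painted i x lo bs d: reading bs as consecutive blocks (lo, b₁], (b₁, b₂], … with colours
-- j₁, j₂, …, x lies in a block of colour i, or beyond the last block with i = d.
data Painted {r} (i : Fin r) (x : ℕ) : ℕ → List (ℕ × Fin r) → Fin r → Set where
  here   : ∀ {lo b bs d} → Ioc lo b x → Painted i x lo ((b , i) ∷ bs) d
  there  : ∀ {lo b j bs d} → Painted i x b bs d → Painted i x lo ((b , j) ∷ bs) d
  beyond : ∀ {lo} → lo < x → Painted i x lo [] i

paint⇒Painted : ∀ {r} {i : Fin r} {x lo} bs d →
                lo < x → paint bs d x ≡ i → Painted i x lo bs d
paint⇒Painted [] d lo<x refl = beyond lo<x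
paint⇒Painted {x = x} ((b , j) ∷ bs) d lo<x eq with x ≤? b
paint⇒Painted (_ ∷ _)  d lo<x refl | yes x≤b = here (lo<x , x≤b)
paint⇒Painted (_ ∷ bs) d lo<x eq   | no  x≰b = there (paint⇒Painted bs d (≰⇒> x≰b) eq)

module Colouring-stu (α τ υ : ℕ) (α≤τ : α ≤ τ) (τ≤υ : τ ≤ υ) where

  -- P = (s-1)(t-1) - 1, Q = (u-1)(P+s-1) - 1 and M = stu-tu-u-2, written without ∸.
  s t u P Q M : ℕ
  s = 2 + α
  t = 2 + τ
  u = 2 + υ
  P = τ * suc α + α
  Q = υ * suc (P + α) + (P + α)
  M = Q + P + α

  ks : Fin 3 → ℕ
  ks = lookup (s ∷ t ∷ u ∷ [])

  blocks : List (ℕ × Fin 3)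
  blocks = (α , 0F) ∷ (P , 1F) ∷ (P + α , 0F) ∷ (Q , 2F)
         ∷ (Q + α , 0F) ∷ (Q + P , 1F) ∷ []

  colouring : Colouring 3
  colouring = paint blocks 0F

  I L J : Pred ℕ 0ℓ
  I = Ioc 0 α
  L = I ∪ Shift P I
  J = Ioc α P

  colour₀⊆ : Coloured M colouring 0F ⊆ L ∪ Shift Q L
  colour₀⊆ ((0<x , x≤M) , cx≡0) with paint⇒Painted blocks 0F 0<x cx≡0
  ... | here x∈I = inj₁ (inj₁ x∈I)
  ... | there (there (here x∈)) = inj₁ (inj₂ (Ioc-Shift₀ x∈))
  ... | there (there (there (there (here x∈)))) = inj₂ (Shift-mono inj₁ (Ioc-Shift₀ x∈))
  ... | there (there (there (there (there (there (beyond Q+P<x)))))) =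
    inj₂ (Shift-mono inj₂ (Shift-+ (Ioc-Shift₀ (Q+P<x , x≤M))))

  colour₁⊆ : Coloured M colouring 1F ⊆ J ∪ Shift Q J
  colour₁⊆ ((0<x , _) , cx≡1) with paint⇒Painted blocks 0F 0<x cx≡1
  ... | there (here x∈J) = inj₁ x∈J
  ... | there (there (there (there (there (here x∈))))) = inj₂ (Ioc-Shift x∈)

  colour₂⊆ : Coloured M colouring 2F ⊆ Ioc (P + α) Q
  colour₂⊆ ((0<x , _) , cx≡2) with paint⇒Painted blocks 0F 0<x cx≡2
  ... | there (there (there (here x∈))) = x∈
  ... | there (there (there (there (there (there ())))))

  [1+α]α≤P : suc α * α ≤ P
  [1+α]α≤P = ≤-trans (≤-reflexive (*-comm (suc α) α))
                     (≤-trans (*-monoˡ-≤ (suc α) α≤τ) (m≤m+n _ α))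

  [1+α][P+α]≤Q : suc α * (P + α) ≤ Q
  [1+α][P+α]≤Q = ≤-trans (+-monoʳ-≤ (P + α) (*-mono-≤ (≤-trans α≤τ τ≤υ) (n≤1+n _)))
                         (≤-reflexive (+-comm (P + α) _))

  [1+τ]P≤Q : suc τ * P ≤ Q
  [1+τ]P≤Q = ≤-trans (+-mono-≤ (m≤m+n P α)
                               (*-mono-≤ τ≤υ (≤-trans (m≤m+n P α) (n≤1+n _))))
                     (≤-reflexive (+-comm (P + α) _))

  colour₀-free : SumFree (suc α) (L ∪ Shift Q L)
  colour₀-free = SumFree-∪-Shift (∪-Shift-⊆ id) [1+α][P+α]≤Q
                   (SumFree-∪-Shift id [1+α]α≤P
                     (SumFree-Ioc (s≤s (≤-reflexive (sym (*-identityʳ α))))))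

  colour₁-free : SumFree (suc τ) (J ∪ Shift Q J)
  colour₁-free = SumFree-∪-Shift J⊆ [1+τ]P≤Q
                   (SumFree-Ioc (s≤s (≤-reflexive (+-comm (τ * suc α) α))))
    where
    J⊆ : J ⊆ Ioc 0 P
    J⊆ (α<x , x≤P) = ≤-trans (s≤s z≤n) α<x , x≤P

  colour₂-free : SumFree (suc υ) (Ioc (P + α) Q)
  colour₂-free = SumFree-Ioc (s≤s (≤-reflexive (+-comm _ (P + α))))

  colouring-sum-free : ∀ i → SumFree (ks i ∸ 1) (Coloured M colouring i)
  colouring-sum-free 0F = SumFree-anti colour₀⊆ colour₀-free
  colouring-sum-free 1F = SumFree-anti colour₁⊆ colour₁-free
  colouring-sum-free 2F = SumFree-anti colour₂⊆ colour₂-free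

  M<S : ∀ {N} → SchurProperty 3 ks N → M < N
  M<S = schur-lower-bound ks colouring colouring-sum-free

  stu≡tu+u+1+[1+M] : s * t * u ≡ t * u + u + 1 + suc M
  stu≡tu+u+1+[1+M] = expand α τ υ
    where
    expand : ∀ a t u → let p = t * suc a + a; q = u * suc (p + a) + (p + a) in
             (2 + a) * (2 + t) * (2 + u) ≡ (2 + t) * (2 + u) + (2 + u) + 1 + suc (q + p + a)
    expand = solve-∀

stu∸[tu+u+1]≤S : ∀ {s t u N} → 2 ≤ s → s ≤ t → t ≤ u →
                 SchurProperty 3 (lookup (s ∷ t ∷ u ∷ [])) N → s * t * u ∸ (t * u + u + 1) ≤ N
stu∸[tu+u+1]≤S {suc (suc α)} {suc (suc τ)} {suc (suc υ)} {N}
               (s≤s (s≤s _)) (s≤s (s≤s α≤τ)) (s≤s (s≤s τ≤υ)) schur =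
  begin
    s * t * u ∸ (t * u + u + 1)             ≡⟨ cong (_∸ (t * u + u + 1)) stu≡tu+u+1+[1+M] ⟩
    t * u + u + 1 + suc M ∸ (t * u + u + 1) ≡⟨ m+n∸m≡n (t * u + u + 1) (suc M) ⟩
    suc M                                   ≤⟨ M<S schur ⟩
    N                                       ∎
  where
  open ≤-Reasoning
  open Colouring-stu α τ υ α≤τ τ≤υ

module Colouring-3tu (b w : ℕ) (b≤1+w : b ≤ suc w) where

  t u β A N₂ : ℕ
  t  = 3 + b
  u  = 4 + w
  β  = 3 + (b + b)
  A  = (3 + w) * (2 + β)
  N₂ = A + suc β

  ks : Fin 3 → ℕ
  ks = lookup (3 ∷ t ∷ u ∷ [])

  blocks : List (ℕ × Fin 3)
  blocks = (1 , 0F) ∷ (β , 1F) ∷ (suc β , 0F) ∷ (2 + β , 2F) ∷ (3 + β , 0F)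
         ∷ (pred A , 2F) ∷ (A , 0F) ∷ (suc A , 2F) ∷ (2 + A , 0F) ∷ []

  colouring : Colouring 3
  colouring = paint blocks 1F

  F E₀ C₁ C₂ : Pred ℕ 0ℓ
  F  = Twin (suc β) ∪ Twin A
  E₀ = (_≡ 1) ∪ F
  C₁ = Ioc 1 β ∪ Ioc (2 + A) N₂
  C₂ = (_≡ 2 + β) ∪ Ioc (3 + β) (pred A) ∪ (_≡ suc A)

  colour₀⊆ : Coloured N₂ colouring 0F ⊆ E₀
  colour₀⊆ ((0<x , _) , cx≡0) with paint⇒Painted blocks 1F 0<x cx≡0
  ... | here x∈ = inj₁ (Ioc-singleton x∈)
  ... | there (there (here x∈)) = inj₂ (inj₁ (inj₁ (Ioc-singleton x∈)))
  ... | there (there (there (there (here x∈)))) = inj₂ (inj₁ (inj₂ (Ioc-singleton x∈)))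
  ... | there (there (there (there (there (there (here x∈)))))) =
    inj₂ (inj₂ (inj₁ (Ioc-singleton x∈)))
  ... | there (there (there (there (there (there (there (there (here x∈)))))))) =
    inj₂ (inj₂ (inj₂ (Ioc-singleton x∈)))
  ... | there (there (there (there (there (there (there (there (there ()))))))))

  colour₁⊆ : Coloured N₂ colouring 1F ⊆ C₁
  colour₁⊆ ((0<x , x≤N₂) , cx≡1) with paint⇒Painted blocks 1F 0<x cx≡1
  ... | there (here x∈) = inj₁ x∈
  ... | there (there (there (there (there (there (there (there (there (beyond 2+A<x))))))))) =
    inj₂ (2+A<x , x≤N₂)

  colour₂⊆ : Coloured N₂ colouring 2F ⊆ C₂
  colour₂⊆ ((0<x , _) , cx≡2) with paint⇒Painted blocks 1F 0<x cx≡2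
  ... | there (there (there (here x∈))) = inj₁ (Ioc-singleton x∈)
  ... | there (there (there (there (there (here x∈))))) = inj₂ (inj₁ x∈)
  ... | there (there (there (there (there (there (there (here x∈))))))) =
    inj₂ (inj₂ (Ioc-singleton x∈))
  ... | there (there (there (there (there (there (there (there (there ()))))))))

  3≤1+β : 3 ≤ suc β
  3≤1+β = s≤s (s≤s (s≤s z≤n))

  3+β<1+β+1+β : 3 + β < suc β + suc β
  3+β<1+β+1+β = s≤s (≤-trans (≤-reflexive (+-comm 3 β)) (+-monoʳ-≤ β 3≤1+β))

  2+A<A+1+β : 2 + A < A + suc β
  2+A<A+1+β = ≤-trans (≤-reflexive (+-comm 3 A)) (+-monoʳ-≤ A 3≤1+β)

  3+β+3+β<A : (3 + β) + (3 + β) < A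
  3+β+3+β<A = ≤-trans (≤-trans (m≤m+n _ (2 + (b + b))) (≤-reflexive (expand b)))
                      (*-monoˡ-≤ (2 + β) (m≤m+n 3 w))
    where
    expand : ∀ b → let β = 3 + (b + b) in suc ((3 + β) + (3 + β)) + (2 + (b + b)) ≡ 3 * (2 + β)
    expand = solve-∀

  4+β<A : 4 + β < A
  4+β<A = ≤-<-trans (m<m+n (3 + β) z<s) 3+β+3+β<A

  F⊆≥1+β : F ⊆ (suc β ≤_)
  F⊆≥1+β (inj₁ x∈) = Twin⇒≥ x∈
  F⊆≥1+β (inj₂ x∈) = ≤-trans (<⇒≤ (≤-<-trans (m≤n+m (suc β) 3) 4+β<A)) (Twin⇒≥ x∈)

  F-bands : F ⊆ λ x → x ≤ 3 + β ⊎ A ≤ x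
  F-bands (inj₁ x∈) = inj₁ (Twin⇒≤ x∈)
  F-bands (inj₂ x∈) = inj₂ (Twin⇒≥ x∈)

  E₀-isolated : ∀ {x} → E₀ x → ¬ E₀ (suc x)
  E₀-isolated (inj₁ refl) (inj₁ ())
  E₀-isolated (inj₁ refl) (inj₂ 2∈F) = <⇒≱ 3≤1+β (F⊆≥1+β 2∈F)
  E₀-isolated (inj₂ x∈F) (inj₁ refl) = n≮0 (F⊆≥1+β x∈F)
  E₀-isolated (inj₂ (inj₁ x∈)) (inj₂ (inj₁ 1+x∈)) = Twin-isolated x∈ 1+x∈
  E₀-isolated (inj₂ (inj₂ x∈)) (inj₂ (inj₂ 1+x∈)) = Twin-isolated x∈ 1+x∈
  E₀-isolated (inj₂ (inj₁ x∈)) (inj₂ (inj₂ 1+x∈)) =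
    <⇒≱ 4+β<A (≤-trans (Twin⇒≥ 1+x∈) (s≤s (Twin⇒≤ x∈)))
  E₀-isolated (inj₂ (inj₂ x∈)) (inj₂ (inj₁ 1+x∈)) =
    <⇒≱ (<⇒≤ 4+β<A) (≤-trans (≤-trans (Twin⇒≥ x∈) (n≤1+n _)) (Twin⇒≤ 1+x∈))

  F-sums : ∀ {x y} → F x → F y → ¬ E₀ (x + y)
  F-sums x∈F y∈F (inj₁ x+y≡1) =
    <⇒≱ (s≤s (s≤s z≤n)) (≤-trans (F⊆≥1+β x∈F) (≤-trans (m≤m+n _ _) (≤-reflexive x+y≡1)))
  F-sums x∈F y∈F (inj₂ (inj₁ x+y∈)) =
    <⇒≱ (≤-<-trans (Twin⇒≤ x+y∈) 3+β<1+β+1+β) (+-mono-≤ (F⊆≥1+β x∈F) (F⊆≥1+β y∈F))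
  F-sums x∈F y∈F (inj₂ (inj₂ x+y∈)) with F-bands x∈F | F-bands y∈F
  ... | inj₁ x≤3+β | inj₁ y≤3+β =
    <⇒≱ 3+β+3+β<A (≤-trans (Twin⇒≥ x+y∈) (+-mono-≤ x≤3+β y≤3+β))
  ... | inj₂ A≤x | _ =
    <⇒≱ 2+A<A+1+β (≤-trans (+-mono-≤ A≤x (F⊆≥1+β y∈F)) (Twin⇒≤ x+y∈))
  ... | inj₁ _ | inj₂ A≤y =
    <⇒≱ 2+A<A+1+β (≤-trans (≤-trans (≤-reflexive (+-comm A (suc β))) (+-mono-≤ (F⊆≥1+β x∈F) A≤y))
                           (Twin⇒≤ x+y∈))

  colour₀-free : SumFree 2 E₀
  colour₀-free (inj₁ refl ∷ y∈E₀ ∷ []) σ∈E₀ =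
    E₀-isolated y∈E₀ (subst (E₀ ∘ suc) (+-identityʳ _) σ∈E₀)
  colour₀-free (_∷_ {x} x∈E₀ (inj₁ refl ∷ [])) σ∈E₀ =
    E₀-isolated x∈E₀ (subst E₀ (+-comm x 1) σ∈E₀)
  colour₀-free (_∷_ {x} (inj₂ x∈F) (inj₂ y∈F ∷ [])) σ∈E₀ =
    F-sums x∈F y∈F (subst E₀ (cong (x +_) (+-identityʳ _)) σ∈E₀)

  colour₁-free : SumFree (2 + b) C₁
  colour₁-free s = excluded (SumOf-∪ proj₁ proj₁ (s≤s (s≤s z≤n)) s)
    where
    [2+b]2≡1+β : (2 + b) * 2 ≡ suc β
    [2+b]2≡1+β = expand b
      where
      expand : ∀ b → (2 + b) * 2 ≡ suc (3 + (b + b))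
      expand = solve-∀

    1+N₂≡3+A+[1+b]2 : suc N₂ ≡ 3 + A + suc b * 2
    1+N₂≡3+A+[1+b]2 = expand A b
      where
      expand : ∀ a b → suc (a + suc (3 + (b + b))) ≡ 3 + a + suc b * 2
      expand = solve-∀

    C₁⊆≤N₂ : C₁ ⊆ (_≤ N₂)
    C₁⊆≤N₂ (inj₁ (_ , x≤β))  = ≤-trans x≤β (≤-trans (n≤1+n β) (m≤n+m _ A))
    C₁⊆≤N₂ (inj₂ (_ , x≤N₂)) = x≤N₂

    excluded : ∀ {σ} → SumOf (Ioc 1 β) (2 + b) σ ⊎ 3 + A + suc b * 2 ≤ σ → ¬ C₁ σ
    excluded (inj₁ s′) (inj₁ (_ , σ≤β)) =
      <⇒≱ (s≤s σ≤β) (≤-trans (≤-reflexive (sym [2+b]2≡1+β)) (SumOf-≥ proj₁ s′))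
    excluded (inj₁ s′) (inj₂ (2+A<σ , _)) =
      <⇒≱ 2+A<σ (≤-trans (SumOf-≤ proj₂ s′)
                         (≤-trans (*-mono-≤ (s≤s (s≤s b≤1+w)) (m≤n+m β 2)) (m≤n+m A 2)))
    excluded (inj₂ big) σ∈C₁ =
      <⇒≱ (≤-trans (≤-reflexive 1+N₂≡3+A+[1+b]2) big) (C₁⊆≤N₂ σ∈C₁)

  colour₂-free : SumFree (3 + w) C₂
  colour₂-free s = excluded (SumOf-∪ (≤-reflexive ∘ sym) D⊆≥4+β (m≤n+m (2 + β) 2) s)
    where
    D⊆≥4+β : Ioc (3 + β) (pred A) ∪ (_≡ suc A) ⊆ (4 + β ≤_)
    D⊆≥4+β (inj₁ (3+β<x , _)) = 3+β<x
    D⊆≥4+β (inj₂ refl)        = ≤-trans (<⇒≤ 4+β<A) (n≤1+n A)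

    C₂⊆≤1+A : C₂ ⊆ (_≤ suc A)
    C₂⊆≤1+A (inj₁ refl)               = ≤-trans (≤-trans (m≤n+m _ 2) (<⇒≤ 4+β<A)) (n≤1+n A)
    C₂⊆≤1+A (inj₂ (inj₁ (_ , x≤A-1))) = ≤-trans x≤A-1 (≤-trans (n≤1+n _) (n≤1+n _))
    C₂⊆≤1+A (inj₂ (inj₂ refl))        = ≤-refl

    A∉C₂ : ¬ C₂ A
    A∉C₂ (inj₁ A≡2+β)              = <⇒≢ (≤-<-trans (m≤n+m _ 2) 4+β<A) (sym A≡2+β)
    A∉C₂ (inj₂ (inj₁ (_ , A≤A-1))) = n≮n _ A≤A-1
    A∉C₂ (inj₂ (inj₂ A≡1+A))       = 1+n≢n (sym A≡1+A)

    excluded : ∀ {σ} → SumOf (_≡ 2 + β) (3 + w) σ ⊎ 4 + β + (2 + w) * (2 + β) ≤ σ →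
               ¬ C₂ σ
    excluded (inj₁ s′)  σ∈C₂ = A∉C₂ (subst C₂ (SumOf-≡ s′) σ∈C₂)
    excluded (inj₂ big) σ∈C₂ = <⇒≱ big (C₂⊆≤1+A σ∈C₂)

  colouring-sum-free : ∀ i → SumFree (ks i ∸ 1) (Coloured N₂ colouring i)
  colouring-sum-free 0F = SumFree-anti colour₀⊆ colour₀-free
  colouring-sum-free 1F = SumFree-anti colour₁⊆ colour₁-free
  colouring-sum-free 2F = SumFree-anti colour₂⊆ colour₂-free

  N₂<S : ∀ {N} → SchurProperty 3 ks N → N₂ < N
  N₂<S = schur-lower-bound ks colouring colouring-sum-free

  2tu≡u+1+N₂ : 2 * t * u ≡ u + 1 + N₂
  2tu≡u+1+N₂ = expand b w
    where
    expand : ∀ b w → let β = 3 + (b + b) in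
             2 * (3 + b) * (4 + w) ≡ 4 + w + 1 + ((3 + w) * (2 + β) + suc β)
    expand = solve-∀

2tu∸[u+1]<S : ∀ {t u N} → 3 ≤ t → t ≤ u → 3 < u →
              SchurProperty 3 (lookup (3 ∷ t ∷ u ∷ [])) N → 2 * t * u ∸ (u + 1) < N
2tu∸[u+1]<S {suc (suc (suc b))} {suc (suc (suc (suc w)))} {N}
            (s≤s (s≤s (s≤s _))) (s≤s (s≤s (s≤s b≤1+w))) (s≤s (s≤s (s≤s (s≤s _)))) schur =
  begin-strict
    2 * t * u ∸ (u + 1)        ≡⟨ cong (_∸ (u + 1)) 2tu≡u+1+N₂ ⟩
    u + 1 + N₂ ∸ (u + 1)       ≡⟨ m+n∸m≡n (u + 1) N₂ ⟩
    N₂                         <⟨ N₂<S schur ⟩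
    N                          ∎
  where
  open ≤-Reasoning
  open Colouring-3tu b w b≤1+w

proposition3p1 :
    ((s t u : ℕ) → 4 ≤ s → s ≤ t → t ≤ u → (N : ℕ) →
      IsSchurNumber 3 (lookup (s ∷ t ∷ u ∷ [])) N →
      s * t * u ∸ (t * u + u + 1) ≤ N)
    ×
    ((t u : ℕ) → 3 ≤ t → t ≤ u → ((t ≡ 3 × 3 < u) ⊎ 3 < t) → (N : ℕ) →
      IsSchurNumber 3 (lookup (3 ∷ t ∷ u ∷ [])) N →
      2 * t * u ∸ (u + 1) < N)
proposition3p1 =
    (λ s t u 4≤s s≤t t≤u N (_ , schur , _) →
       stu∸[tu+u+1]≤S (≤-trans (s≤s (s≤s z≤n)) 4≤s) s≤t t≤u schur)
  , (λ t u 3≤t t≤u cases N (_ , schur , _) →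
       2tu∸[u+1]<S 3≤t t≤u (3<u t≤u cases) schur)
  where
  3<u : ∀ {t u} → t ≤ u → (t ≡ 3 × 3 < u) ⊎ 3 < t → 3 < u
  3<u _   (inj₁ (_ , 3<u)) = 3<u
  3<u t≤u (inj₂ 3<t)       = <-≤-trans 3<t t≤u
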